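{- Let $(T,g)$ be a structured tree such that for every internal node $v$ of $T$, the graph $g(v)$ belongs to $\mathcal{C}$. Then the realization $R(T,g)$ belongs to $\mathcal{C}$.
   Context: Let $\mathcal{C}$ be the smallest class of graphs containing all graphs with at most two vertices and closed under the following two operations: (i) substituting a vertex by a stable set of size two (i.e., adding a new vertex with exactly the same neighborhood as an existing vertex and non-adjacent to it); (ii) gluing two graphs of $\mathcal{C}$ along a stable set of size at most two (i.e., taking two graphs $H_1,H_2\in\mathcal{C}$, stable sets $S_1\subseteq V(H_1)$, $S_2\subseteq V(H_2)$ with $|S_1|=|S_2|\le 2$, and a bijection between them, and forming the disjoint union of $H_1$ and $H_2$ with the vertices of $S_1$ identified with the corresponding vertices of $S_2$). A structured tree is a pair $(T,g)$ where $T$ is a rooted tree and $g$ is a function defined on the internal (non-leaf) nodes $v$ of $T$ such that $g(v)$ is a graph whose vertex set is the set of children of $v$ in $T$. A branch of $T$ is a path in $T$ from the root to a leaf. The realization $R(T,g)$ is the graph with vertex set $V(T)\cup B$, where $B$ is a set of new vertices in bijection with the branches of $T$ (called branch vertices). Its edges are: all pairs $uv$ where $u,v$ are children of a common internal node $z$ and $uv$ is an edge of $g(z)$; and, for each branch vertex $b$, all pairs $bw$ with $w$ a node of $T$ lying on the branch $b$. The edges of $T$ itself are not edges of $R(T,g)$. (If $T$ is a single root vertex, $R(T,g)=K_2$.) -}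

module Defs where

open import Level using (0ℓ; Lift)
open import Data.Nat using (ℕ; suc; _≤_)
open import Data.Fin using (Fin)
open import Data.Product using (Σ; Σ-syntax; ∃; ∃-syntax; _×_; _,_)
open import Data.Sum using (_⊎_; inj₁; inj₂)
open import Data.Unit using (⊤)
open import Data.Empty using (⊥)
open import Data.Unit using (tt)
open import Relation.Nullary using (¬_)
open import Relation.Binary.PropositionalEquality using (_≡_; _≢_; refl; subst)
open import Function.Bundles using (_↔_; _⇔_)

record Graph : Set₁ where
  field
    V      : Set
    _~_    : V → V → Set
    ~-sym  : ∀ {u v} → u ~ v → v ~ u
    ~-irr  : ∀ {v} → ¬ (v ~ v)
open Graph public

-- Operation (i): G is obtained from H by substituting vertex v by a stable
-- set of size two (new vertex w, twin of v, non-adjacent to it).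
-- Stated up to isomorphism via an embedding φ of H into G.

record TwinExt (H : Graph) (v : V H) (G : Graph) : Set where
  field
    φ       : V H → V G
    φ-inj   : ∀ a b → φ a ≡ φ b → a ≡ b
    w       : V G
    w-new   : ∀ a → φ a ≢ w
    cover   : ∀ x → (∃[ a ] φ a ≡ x) ⊎ (x ≡ w)
    φ-adj   : ∀ a b → (_~_ G (φ a) (φ b) ⇔ _~_ H a b)
    w-adj   : ∀ a → (_~_ G w (φ a) ⇔ _~_ H v a)

-- Operation (ii): G is obtained by gluing H₁ and H₂ along stable sets
-- S₁ = {s₁ i}, S₂ = {s₂ i} (i : Fin k, k ≤ 2) with bijection s₁ i ↦ s₂ i.
-- Stated up to isomorphism via embeddings φ₁, φ₂ into G.

record Gluing (H₁ H₂ G : Graph) : Set where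
  field
    k        : ℕ
    k≤2      : k ≤ 2
    s₁       : Fin k → V H₁
    s₂       : Fin k → V H₂
    s₁-inj   : ∀ i j → s₁ i ≡ s₁ j → i ≡ j
    s₂-inj   : ∀ i j → s₂ i ≡ s₂ j → i ≡ j
    s₁-stab  : ∀ i j → ¬ (_~_ H₁ (s₁ i) (s₁ j))
    s₂-stab  : ∀ i j → ¬ (_~_ H₂ (s₂ i) (s₂ j))
    φ₁       : V H₁ → V G
    φ₂       : V H₂ → V G
    φ₁-inj   : ∀ a b → φ₁ a ≡ φ₁ b → a ≡ b
    φ₂-inj   : ∀ a b → φ₂ a ≡ φ₂ b → a ≡ b
    agree    : ∀ i → φ₁ (s₁ i) ≡ φ₂ (s₂ i)
    meet     : ∀ a b → φ₁ a ≡ φ₂ b → ∃[ i ] (a ≡ s₁ i × b ≡ s₂ i)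
    cover    : ∀ x → (∃[ a ] φ₁ a ≡ x) ⊎ (∃[ b ] φ₂ b ≡ x)
    adj      : ∀ x y → (_~_ G x y ⇔
                 ((Σ[ a ∈ V H₁ ] Σ[ b ∈ V H₁ ] (φ₁ a ≡ x × φ₁ b ≡ y × _~_ H₁ a b))
                 ⊎ (Σ[ a ∈ V H₂ ] Σ[ b ∈ V H₂ ] (φ₂ a ≡ x × φ₂ b ≡ y × _~_ H₂ a b))))

-- The class 𝒞 (smallest class containing graphs on ≤ 2 vertices, closed
-- under operations (i) and (ii); closure under isomorphism is built in).

data 𝒞 : Graph → Set₁ where
  small : ∀ {G : Graph} (n : ℕ) → n ≤ 2 → (V G ↔ Fin n) → 𝒞 G
  twin  : ∀ {H G : Graph} (v : V H) → 𝒞 H → TwinExt H v G → 𝒞 G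
  glue  : ∀ {H₁ H₂ G : Graph} → 𝒞 H₁ → 𝒞 H₂ → Gluing H₁ H₂ G → 𝒞 G

-- Graphs on Fin n (used for g(v), whose vertex set is the set of children)

record FinGraph (n : ℕ) : Set₁ where
  field
    adj     : Fin n → Fin n → Set
    adj-sym : ∀ {i j} → adj i j → adj j i
    adj-irr : ∀ {i} → ¬ adj i i
open FinGraph public

toGraph : ∀ {n} → FinGraph n → Graph
toGraph {n} h = record { V = Fin n ; _~_ = adj h ; ~-sym = adj-sym h ; ~-irr = adj-irr h }

data STree : Set₁ where
  leaf  : STree
  inner : (n : ℕ) → FinGraph (suc n) → (Fin (suc n) → STree) → STree

-- Nodes of T (paths from the root): the root, or a child i followed by a
-- node of the subtree rooted at that child.
Node : STree → Set
Node leaf          = ⊤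
Node (inner n h c) = ⊤ ⊎ (Σ[ i ∈ Fin (suc n) ] Node (c i))

root : ∀ t → Node t
root leaf          = _
root (inner n h c) = inj₁ _

-- Branches of T (root-to-leaf paths)
Branch : STree → Set
Branch leaf          = ⊤
Branch (inner n h c) = Σ[ i ∈ Fin (suc n) ] Branch (c i)

OnBranch : ∀ t → Node t → Branch t → Set
OnBranch leaf          _              _       = ⊤
OnBranch (inner n h c) (inj₁ _)       _       = ⊤
OnBranch (inner n h c) (inj₂ (i , x)) (j , b) =
  Σ[ e ∈ i ≡ j ] OnBranch (c j) (subst (λ k → Node (c k)) e x) b

IsRoot : ∀ t → Node t → Set
IsRoot leaf          _        = ⊤
IsRoot (inner n h c) (inj₁ _) = ⊤
IsRoot (inner n h c) (inj₂ _) = ⊥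

-- Two nodes are children of a common internal node z and adjacent in g(z)
SibAdj : ∀ t → Node t → Node t → Set
SibAdj leaf          _              _              = ⊥
SibAdj (inner n h c) (inj₁ _)       _              = ⊥
SibAdj (inner n h c) (inj₂ _)       (inj₁ _)       = ⊥
SibAdj (inner n h c) (inj₂ (i , x)) (inj₂ (j , y)) =
  (IsRoot (c i) x × IsRoot (c j) y × adj h i j)
  ⊎ (Σ[ e ∈ i ≡ j ] SibAdj (c j) (subst (λ k → Node (c k)) e x) y)

AllIn𝒞 : STree → Set₁
AllIn𝒞 leaf          = Lift _ ⊤
AllIn𝒞 (inner n h c) = 𝒞 (toGraph h) × (∀ i → AllIn𝒞 (c i))

sib-sym : ∀ t {x y : Node t} → SibAdj t x y → SibAdj t y x
sib-sym (inner n h c) {inj₂ (i , x)} {inj₂ (j , y)} (inj₁ (rx , ry , e)) = inj₁ (ry , rx , adj-sym h e)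
sib-sym (inner n h c) {inj₂ (i , x)} {inj₂ (.i , y)} (inj₂ (refl , s)) = inj₂ (refl , sib-sym (c i) s)

sib-irr : ∀ t {x : Node t} → ¬ SibAdj t x x
sib-irr (inner n h c) {inj₂ (i , x)} (inj₁ (_ , _ , e)) = adj-irr h e
sib-irr (inner n h c) {inj₂ (i , x)} (inj₂ (refl , s)) = sib-irr (c i) s

RAdj : ∀ t → Node t ⊎ Branch t → Node t ⊎ Branch t → Set
RAdj t (inj₁ x) (inj₁ y) = SibAdj t x y
RAdj t (inj₁ x) (inj₂ b) = OnBranch t x b
RAdj t (inj₂ b) (inj₁ x) = OnBranch t x b
RAdj t (inj₂ _) (inj₂ _) = ⊥

RAdj-sym : ∀ t {u v} → RAdj t u v → RAdj t v u
RAdj-sym t {inj₁ x} {inj₁ y} s = sib-sym t s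
RAdj-sym t {inj₁ x} {inj₂ b} o = o
RAdj-sym t {inj₂ b} {inj₁ x} o = o

RAdj-irr : ∀ t {v} → ¬ RAdj t v v
RAdj-irr t {inj₁ x} s = sib-irr t s

R : STree → Graph
R t = record { V = Node t ⊎ Branch t ; _~_ = RAdj t ; ~-sym = λ {u} {v} → RAdj-sym t {u} {v} ; ~-irr = λ {v} → RAdj-irr t {v} }

-- Let t have root r (the apex) and children 1, …, m with subtrees t₁, …, tₘ. The subgraph of
-- R(t) induced by r and the children is g(r) plus the isolated vertex r, a gluing
-- along the empty set. The subtree tⱼ contributes a copy of R(tⱼ) in which the
-- child j plays the root of tⱼ, together with r, which is adjacent exactly to the
-- branch vertices of tⱼ, i.e. is a twin of the root of R(tⱼ). Each such piece meets
-- the rest of R(t) in the stable pair {r, j} and has no edges leaving it, so adding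
-- the subtrees one at a time is a sequence of gluings along stable pairs.
module Submission where

open import Defs
open import Data.Bool using (Bool; true; false; T; _∨_)
open import Data.Bool.Properties using (T-∨; T-irrelevant; T?)
open import Data.Empty using (⊥; ⊥-elim)
open import Data.Fin using (Fin; zero; suc; _≟_)
open import Data.List using (List; []; _∷_; allFin)
open import Data.List.Membership.Propositional using (_∈_)
open import Data.List.Membership.Propositional.Properties using (∈-allFin)
open import Data.List.Relation.Unary.All as All using (All)
open import Data.List.Relation.Unary.Any using (here; there)
open import Data.List.Relation.Unary.Unique.Propositional using (Unique; []; _∷_)
open import Data.List.Relation.Unary.Unique.Propositional.Properties using (allFin⁺)
open import Data.Nat using (ℕ; suc; _≤_; z≤n; s≤s)
open import Data.Nat.Properties using (≤-refl)
open import Data.Product using (Σ; ∃-syntax; _×_; _,_; proj₁)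
open import Data.Sum using (_⊎_; inj₁; inj₂; [_,_])
import Data.Sum as Sum
open import Data.Unit using (⊤; tt)
open import Function using (_∘_; id)
open import Function.Bundles using (_↔_; _⇔_; mk⇔; mk↔ₛ′; Inverse; Equivalence; Injection)
open import Function.Properties.Inverse using (↔⇒↣)
open import Relation.Nullary using (¬_; Dec; yes; no)
open import Relation.Nullary.Decidable using (⌊_⌋; toWitness; fromWitness)
open import Relation.Binary.PropositionalEquality using (_≡_; _≢_; refl; sym; trans; cong; subst₂)

record _≅_ (G H : Graph) : Set where
  field
    vertices : V G ↔ V H
  open Inverse vertices public
  field
    ~-iff : ∀ x y → _~_ G x y ⇔ _~_ H (to x) (to y)

∅ : Graph
∅ = record { V = ⊥ ; _~_ = λ _ _ → ⊥ ; ~-sym = λ () ; ~-irr = λ () }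

∅∈𝒞 : 𝒞 ∅
∅∈𝒞 = small 0 z≤n (mk↔ₛ′ (λ ()) (λ ()) (λ ()) (λ ()))

-- Gluing with the empty graph along the empty set realises any isomorphism.
𝒞-resp-≅ : ∀ {G H} → G ≅ H → 𝒞 G → 𝒞 H
𝒞-resp-≅ {G} {H} G≅H 𝒞G = glue 𝒞G ∅∈𝒞 record
  { k = 0 ; k≤2 = z≤n
  ; s₁ = λ () ; s₂ = λ () ; s₁-inj = λ () ; s₂-inj = λ () ; s₁-stab = λ () ; s₂-stab = λ ()
  ; φ₁ = to ; φ₂ = λ ()
  ; φ₁-inj = λ _ _ → Injection.injective (↔⇒↣ vertices) ; φ₂-inj = λ ()
  ; agree = λ () ; meet = λ _ ()
  ; cover = λ y → inj₁ (from y , strictlyInverseˡ y)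
  ; adj = λ x y → mk⇔ (inj₁ ∘ reflect x y)
      λ { (inj₁ (a , b , refl , refl , e)) → Equivalence.to (~-iff a b) e ; (inj₂ (() , _)) }
  }
  where
  open _≅_ G≅H
  reflect : ∀ x y → _~_ H x y → Σ (V G) λ a → Σ (V G) λ b → to a ≡ x × to b ≡ y × _~_ G a b
  reflect x y e = from x , from y , strictlyInverseˡ x , strictlyInverseˡ y ,
    Equivalence.from (~-iff (from x) (from y))
      (subst₂ (_~_ H) (sym (strictlyInverseˡ x)) (sym (strictlyInverseˡ y)) e)

_∪_ : {X : Set} → (X → Bool) → (X → Bool) → X → Bool
(A ∪ B) x = A x ∨ B x

Induced : (G : Graph) → (V G → Bool) → Graph
Induced G A = record
  { V = Σ (V G) (T ∘ A) ; _~_ = λ x y → _~_ G (proj₁ x) (proj₁ y) ; ~-sym = ~-sym G ; ~-irr = ~-irr G }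

induced-≡ : ∀ {X : Set} (A : X → Bool) {x y : Σ X (T ∘ A)} → proj₁ x ≡ proj₁ y → x ≡ y
induced-≡ _ {x = x , p} {y = .x , q} refl = cong (x ,_) (T-irrelevant p q)

induced-full : ∀ {G A} → (∀ x → T (A x)) → Induced G A ≅ G
induced-full {A = A} all = record
  { vertices = mk↔ₛ′ proj₁ (λ x → x , all x) (λ _ → refl) (λ _ → induced-≡ A refl)
  ; ~-iff = λ _ _ → mk⇔ id id
  }

record Separation (G : Graph) (A B : V G → Bool) : Set where
  field
    k        : ℕ
    k≤2      : k ≤ 2
    s        : Fin k → V G
    s-inj    : ∀ i j → s i ≡ s j → i ≡ j
    s-stable : ∀ i j → ¬ _~_ G (s i) (s j)
    s∈A      : ∀ i → T (A (s i))
    s∈B      : ∀ i → T (B (s i))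
    A∩B⊆s    : ∀ x → T (A x) → T (B x) → ∃[ i ] x ≡ s i
    no-cross : ∀ x y → _~_ G x y → T (A x) → T (B y) → T (A y) ⊎ T (B x)

separation-gluing : ∀ {G A B} → Separation G A B → Gluing (Induced G A) (Induced G B) (Induced G (A ∪ B))
separation-gluing {G} {A} {B} sep = record
  { k = k ; k≤2 = k≤2
  ; s₁ = λ i → s i , s∈A i ; s₂ = λ i → s i , s∈B i
  ; s₁-inj = λ i j → s-inj i j ∘ cong proj₁ ; s₂-inj = λ i j → s-inj i j ∘ cong proj₁
  ; s₁-stab = s-stable ; s₂-stab = s-stable
  ; φ₁ = widenˡ ; φ₂ = widenʳ
  ; φ₁-inj = λ _ _ → induced-≡ A ∘ cong proj₁ ; φ₂-inj = λ _ _ → induced-≡ B ∘ cong proj₁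
  ; agree = λ _ → induced-≡ (A ∪ B) refl
  ; meet = meet
  ; cover = cover
  ; adj = λ { (x , p) (y , q) → mk⇔
      (λ e → Sum.map (λ (ax , ay) → (x , ax) , (y , ay) , induced-≡ (A ∪ B) refl , induced-≡ (A ∪ B) refl , e)
                     (λ (bx , by) → (x , bx) , (y , by) , induced-≡ (A ∪ B) refl , induced-≡ (A ∪ B) refl , e)
                     (same-side x y e p q))
      λ { (inj₁ (_ , _ , refl , refl , e)) → e ; (inj₂ (_ , _ , refl , refl , e)) → e } }
  }
  where
  open Separation sep

  widenˡ : V (Induced G A) → V (Induced G (A ∪ B))
  widenˡ (x , p) = x , Equivalence.from T-∨ (inj₁ p)

  widenʳ : V (Induced G B) → V (Induced G (A ∪ B))
  widenʳ (x , p) = x , Equivalence.from T-∨ (inj₂ p)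

  meet : ∀ a b → widenˡ a ≡ widenʳ b → ∃[ i ] (a ≡ (s i , s∈A i) × b ≡ (s i , s∈B i))
  meet (x , p) (y , q) e with cong proj₁ e
  ... | refl with A∩B⊆s x p q
  ... | i , refl = i , induced-≡ A refl , induced-≡ B refl

  cover : ∀ z → (∃[ a ] widenˡ a ≡ z) ⊎ (∃[ b ] widenʳ b ≡ z)
  cover (x , p) with Equivalence.to T-∨ p
  ... | inj₁ ax = inj₁ ((x , ax) , induced-≡ (A ∪ B) refl)
  ... | inj₂ bx = inj₂ ((x , bx) , induced-≡ (A ∪ B) refl)

  same-side : ∀ x y → _~_ G x y → T ((A ∪ B) x) → T ((A ∪ B) y) →
              T (A x) × T (A y) ⊎ T (B x) × T (B y)
  same-side x y e p q with Equivalence.to T-∨ p | Equivalence.to T-∨ q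
  ... | inj₁ ax | inj₁ ay = inj₁ (ax , ay)
  ... | inj₂ bx | inj₂ by = inj₂ (bx , by)
  ... | inj₁ ax | inj₂ by = [ (λ ay → inj₁ (ax , ay)) , (λ bx → inj₂ (bx , by)) ] (no-cross x y e ax by)
  ... | inj₂ bx | inj₁ ay = [ (λ ax → inj₁ (ax , ay)) , (λ by → inj₂ (bx , by)) ] (no-cross y x (~-sym G e) ay bx)

isRoot? : ∀ t x → Dec (IsRoot t x)
isRoot? leaf          _        = yes tt
isRoot? (inner _ _ _) (inj₁ _) = yes tt
isRoot? (inner _ _ _) (inj₂ _) = no λ ()

IsRoot-root : ∀ t → IsRoot t (root t)
IsRoot-root leaf          = tt
IsRoot-root (inner _ _ _) = tt

IsRoot⇒≡root : ∀ t {x} → IsRoot t x → x ≡ root t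
IsRoot⇒≡root leaf                   _ = refl
IsRoot⇒≡root (inner _ _ _) {inj₁ _} _ = refl

¬SibAdj-root : ∀ t y → ¬ SibAdj t (root t) y
¬SibAdj-root leaf          _ ()
¬SibAdj-root (inner _ _ _) _ ()

OnBranch-root : ∀ t b → OnBranch t (root t) b
OnBranch-root leaf          _ = tt
OnBranch-root (inner _ _ _) _ = tt

R-leaf∈𝒞 : 𝒞 (R leaf)
R-leaf∈𝒞 = small 2 ≤-refl
  (mk↔ₛ′ to from (λ { zero → refl ; (suc zero) → refl }) λ { (inj₁ _) → refl ; (inj₂ _) → refl })
  where
  to : ⊤ ⊎ ⊤ → Fin 2
  to (inj₁ _) = zero
  to (inj₂ _) = suc zero
  from : Fin 2 → ⊤ ⊎ ⊤
  from zero       = inj₁ tt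
  from (suc zero) = inj₂ tt

module Realization {n : ℕ} (h : FinGraph (suc n)) (c : Fin (suc n) → STree) where

  t : STree
  t = inner n h c

  ≟-sound : ∀ {i j : Fin (suc n)} → T ⌊ i ≟ j ⌋ → i ≡ j
  ≟-sound {i} {j} = toWitness {a? = i ≟ j}

  isRoot?-complete : ∀ i {x} → IsRoot (c i) x → T ⌊ isRoot? (c i) x ⌋
  isRoot?-complete i {x} = fromWitness {a? = isRoot? (c i) x}

  apex : V (R t)
  apex = inj₁ (inj₁ tt)

  childRoot : Fin (suc n) → V (R t)
  childRoot i = inj₁ (inj₂ (i , root (c i)))

  isApex : V (R t) → Bool
  isApex (inj₁ (inj₁ _)) = true
  isApex _               = false

  isChildRoot : V (R t) → Bool
  isChildRoot (inj₁ (inj₂ (i , x))) = ⌊ isRoot? (c i) x ⌋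
  isChildRoot _                     = false

  inChild : Fin (suc n) → V (R t) → Bool
  inChild j (inj₁ (inj₁ _))       = false
  inChild j (inj₁ (inj₂ (i , _))) = ⌊ i ≟ j ⌋
  inChild j (inj₂ (i , _))        = ⌊ i ≟ j ⌋

  Top : V (R t) → Bool
  Top = isApex ∪ isChildRoot

  Subtree : Fin (suc n) → V (R t) → Bool
  Subtree j = isApex ∪ inChild j

  Expanded : List (Fin (suc n)) → V (R t) → Bool
  Expanded []       = Top
  Expanded (j ∷ js) = Expanded js ∪ Subtree j

  Top⊆Expanded : ∀ js x → T (Top x) → T (Expanded js x)
  Top⊆Expanded []       x p = p
  Top⊆Expanded (j ∷ js) x p = Equivalence.from T-∨ (inj₁ (Top⊆Expanded js x p))

  inChild⊆Expanded : ∀ {js i} x → i ∈ js → T (inChild i x) → T (Expanded js x)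
  inChild⊆Expanded {_ ∷ js} x (here refl) p =
    Equivalence.from (T-∨ {Expanded js x}) (inj₂ (Equivalence.from (T-∨ {isApex x}) (inj₂ p)))
  inChild⊆Expanded x (there i∈js) p = Equivalence.from T-∨ (inj₁ (inChild⊆Expanded x i∈js p))

  Expanded-cases : ∀ js x → T (Expanded js x) → T (Top x) ⊎ ∃[ i ] (i ∈ js × T (inChild i x))
  Expanded-cases []       x p = inj₁ p
  Expanded-cases (j ∷ js) x p with Equivalence.to T-∨ p
  ... | inj₁ q = Sum.map id (λ (i , i∈js , q) → i , there i∈js , q) (Expanded-cases js x q)
  ... | inj₂ q with Equivalence.to T-∨ q
  ...   | inj₁ a = inj₁ (Equivalence.from T-∨ (inj₁ a))
  ...   | inj₂ q = inj₂ (j , here refl , q)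

  subtree-neighbour : ∀ j x y → RAdj t x y → T (inChild j y) → ¬ T (Top y) → T (Subtree j x)
  subtree-neighbour j (inj₁ (inj₁ _))       (inj₂ _)              _                 _  _    = tt
  subtree-neighbour j (inj₁ (inj₂ (i , _))) (inj₁ (inj₂ (.i , _))) (inj₂ (refl , _)) ic _    = ic
  subtree-neighbour j (inj₁ (inj₂ _))       (inj₁ (inj₂ (i , _))) (inj₁ (_ , r , _)) _  ¬top =
    ⊥-elim (¬top (isRoot?-complete i r))
  subtree-neighbour j (inj₁ (inj₂ (i , _))) (inj₂ (.i , _))       (refl , _)        ic _    = ic
  subtree-neighbour j (inj₂ (i , _))        (inj₁ (inj₂ (.i , _))) (refl , _)        ic _    = ic

  top-separation : Separation (R t) isApex isChildRoot
  top-separation = record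
    { k = 0 ; k≤2 = z≤n ; s = λ () ; s-inj = λ () ; s-stable = λ () ; s∈A = λ () ; s∈B = λ ()
    ; A∩B⊆s = λ x p q → ⊥-elim (disjoint x p q) ; no-cross = no-cross }
    where
    disjoint : ∀ x → T (isApex x) → ¬ T (isChildRoot x)
    disjoint (inj₁ (inj₁ _)) _ ()
    no-cross : ∀ x y → RAdj t x y → T (isApex x) → T (isChildRoot y) → T (isApex y) ⊎ T (isChildRoot x)
    no-cross (inj₁ (inj₁ _)) (inj₁ (inj₂ _)) ()

  apex∈𝒞 : 𝒞 (Induced (R t) isApex)
  apex∈𝒞 = small 1 (s≤s z≤n) (mk↔ₛ′ (λ _ → zero) (λ _ → apex , tt) (λ { zero → refl ; (suc ()) })
    λ { (inj₁ (inj₁ _) , _) → refl ; (inj₁ (inj₂ _) , ()) ; (inj₂ _ , ()) })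

  childRoots≅ : toGraph h ≅ Induced (R t) isChildRoot
  childRoots≅ = record
    { vertices = mk↔ₛ′ (λ i → childRoot i , isRoot?-complete i (IsRoot-root (c i)))
                       owner to∘from (λ _ → refl)
    ; ~-iff = λ i j → mk⇔ (λ a → inj₁ (IsRoot-root (c i) , IsRoot-root (c j) , a))
        λ { (inj₁ (_ , _ , a)) → a ; (inj₂ (refl , s)) → ⊥-elim (¬SibAdj-root (c i) _ s) }
    }
    where
    owner : V (Induced (R t) isChildRoot) → Fin (suc n)
    owner (inj₁ (inj₂ (i , _)) , _) = i
    owner (inj₁ (inj₁ _) , ())
    owner (inj₂ _ , ())
    to∘from : ∀ x → (childRoot (owner x) , isRoot?-complete (owner x) (IsRoot-root (c (owner x)))) ≡ x
    to∘from (inj₁ (inj₂ (i , x)) , p) =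
      induced-≡ isChildRoot (cong (λ z → inj₁ (inj₂ (i , z))) (sym (IsRoot⇒≡root (c i) (toWitness p))))
    to∘from (inj₁ (inj₁ _) , ())
    to∘from (inj₂ _ , ())

  subtree-separation : ∀ {j js} → All (j ≢_) js → Separation (R t) (Expanded js) (Subtree j)
  subtree-separation {j} {js} j∉js = record
    { k = 2 ; k≤2 = ≤-refl ; s = pair
    ; s-inj = λ { zero zero _ → refl ; (suc zero) (suc zero) _ → refl ; zero (suc zero) () ; (suc zero) zero () }
    ; s-stable = λ { zero zero () ; zero (suc zero) () ; (suc zero) zero ()
                   ; (suc zero) (suc zero) → ~-irr (R t) {childRoot j} }
    ; s∈A = λ i → Top⊆Expanded js (pair i) (pair-top i)
    ; s∈B = λ { zero → tt ; (suc zero) → fromWitness refl }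
    ; A∩B⊆s = A∩B⊆pair
    ; no-cross = no-cross
    }
    where
    pair : Fin 2 → V (R t)
    pair zero       = apex
    pair (suc zero) = childRoot j

    pair-top : ∀ i → T (Top (pair i))
    pair-top zero       = tt
    pair-top (suc zero) = isRoot?-complete j (IsRoot-root (c j))

    outside : ∀ {i} x → i ∈ js → T (inChild i x) → ¬ T (inChild j x)
    outside (inj₁ (inj₂ _)) i∈js p q = All.lookup j∉js i∈js (trans (sym (≟-sound q)) (≟-sound p))
    outside (inj₂ _)        i∈js p q = All.lookup j∉js i∈js (trans (sym (≟-sound q)) (≟-sound p))

    A∩B⊆pair : ∀ x → T (Expanded js x) → T (Subtree j x) → ∃[ i ] x ≡ pair i
    A∩B⊆pair (inj₁ (inj₁ _)) _ _ = zero , refl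
    A∩B⊆pair x@(inj₁ (inj₂ (i , y))) p q with ≟-sound q | Expanded-cases js x p
    ... | refl | inj₁ r = suc zero , cong (λ z → inj₁ (inj₂ (i , z))) (IsRoot⇒≡root (c i) (toWitness r))
    ... | refl | inj₂ (k , k∈js , ic) = ⊥-elim (outside x k∈js ic q)
    A∩B⊆pair x@(inj₂ _) p q with Expanded-cases js x p
    ... | inj₂ (k , k∈js , ic) = ⊥-elim (outside x k∈js ic q)

    no-cross : ∀ x y → RAdj t x y → T (Expanded js x) → T (Subtree j y) → T (Expanded js y) ⊎ T (Subtree j x)
    no-cross x y e _ q with T? (Expanded js y) | Equivalence.to T-∨ q
    ... | yes p | _      = inj₁ p
    ... | no ¬p | inj₁ a = ⊥-elim (¬p (Top⊆Expanded js y (Equivalence.from T-∨ (inj₁ a))))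
    ... | no ¬p | inj₂ ic = inj₂ (subtree-neighbour j x y e ic (¬p ∘ Top⊆Expanded js y))

  embed : ∀ j → V (R (c j)) → V (R t)
  embed j (inj₁ x) = inj₁ (inj₂ (j , x))
  embed j (inj₂ b) = inj₂ (j , b)

  apex-twin : ∀ j → TwinExt (R (c j)) (inj₁ (root (c j))) (Induced (R t) (Subtree j))
  apex-twin j = record
    { φ = into
    ; φ-inj = λ a b → embed-injective a b ∘ cong proj₁
    ; w = apex , tt
    ; w-new = λ { (inj₁ _) () ; (inj₂ _) () }
    ; cover = cover
    ; φ-adj = φ-adj
    ; w-adj = w-adj
    }
    where
    embed∈Subtree : ∀ a → T (Subtree j (embed j a))
    embed∈Subtree (inj₁ _) = fromWitness refl
    embed∈Subtree (inj₂ _) = fromWitness refl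

    into : V (R (c j)) → V (Induced (R t) (Subtree j))
    into a = embed j a , embed∈Subtree a

    embed-injective : ∀ a b → embed j a ≡ embed j b → a ≡ b
    embed-injective (inj₁ _) (inj₁ _) refl = refl
    embed-injective (inj₂ _) (inj₂ _) refl = refl
    embed-injective (inj₁ _) (inj₂ _) ()
    embed-injective (inj₂ _) (inj₁ _) ()

    cover : ∀ x → (∃[ a ] into a ≡ x) ⊎ (x ≡ (apex , tt))
    cover (inj₁ (inj₁ _) , _) = inj₂ refl
    cover (inj₁ (inj₂ (i , x)) , p) with ≟-sound p
    ... | refl = inj₁ (inj₁ x , induced-≡ (Subtree j) refl)
    cover (inj₂ (i , b) , p) with ≟-sound p
    ... | refl = inj₁ (inj₂ b , induced-≡ (Subtree j) refl)

    φ-adj : ∀ a b → RAdj t (embed j a) (embed j b) ⇔ RAdj (c j) a b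
    φ-adj (inj₁ _) (inj₁ _) = mk⇔ (λ { (inj₁ (_ , _ , a)) → ⊥-elim (adj-irr h a) ; (inj₂ (refl , s)) → s })
                                  (λ s → inj₂ (refl , s))
    φ-adj (inj₁ _) (inj₂ _) = mk⇔ (λ { (refl , o) → o }) (refl ,_)
    φ-adj (inj₂ _) (inj₁ _) = mk⇔ (λ { (refl , o) → o }) (refl ,_)
    φ-adj (inj₂ _) (inj₂ _) = mk⇔ id id

    w-adj : ∀ a → RAdj t apex (embed j a) ⇔ RAdj (c j) (inj₁ (root (c j))) a
    w-adj (inj₁ x) = mk⇔ (λ ()) (¬SibAdj-root (c j) x)
    w-adj (inj₂ b) = mk⇔ (λ _ → OnBranch-root (c j) b) (λ _ → tt)

  Expanded∈𝒞 : 𝒞 (toGraph h) → (∀ i → 𝒞 (R (c i))) →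
               ∀ {js} → Unique js → 𝒞 (Induced (R t) (Expanded js))
  Expanded∈𝒞 𝒞h _ [] =
    glue apex∈𝒞 (𝒞-resp-≅ childRoots≅ 𝒞h) (separation-gluing top-separation)
  Expanded∈𝒞 𝒞h 𝒞c {j ∷ _} (j∉js ∷ u) =
    glue (Expanded∈𝒞 𝒞h 𝒞c u) (twin _ (𝒞c j) (apex-twin j)) (separation-gluing (subtree-separation j∉js))

  Expanded-allFin : ∀ x → T (Expanded (allFin (suc n)) x)
  Expanded-allFin x@(inj₁ (inj₁ _))       = Top⊆Expanded (allFin (suc n)) x tt
  Expanded-allFin x@(inj₁ (inj₂ (i , _))) = inChild⊆Expanded x (∈-allFin i) (fromWitness refl)
  Expanded-allFin x@(inj₂ (i , _))        = inChild⊆Expanded x (∈-allFin i) (fromWitness refl)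

  R∈𝒞 : 𝒞 (toGraph h) → (∀ i → 𝒞 (R (c i))) → 𝒞 (R t)
  R∈𝒞 𝒞h 𝒞c = 𝒞-resp-≅ (induced-full Expanded-allFin) (Expanded∈𝒞 𝒞h 𝒞c (allFin⁺ (suc n)))

lemma1 : (T : STree) → AllIn𝒞 T → 𝒞 (R T)
lemma1 leaf          _          = R-leaf∈𝒞
lemma1 (inner n h c) (𝒞h , 𝒞c) = Realization.R∈𝒞 h c 𝒞h (λ i → lemma1 (c i) (𝒞c i))
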